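{- Consider the bridge-burning game on the grid $G_{2,n}$. If a cop starts in column $j$ with $1\le j\le 3$ and the robber starts in a column with index smaller than $j$, then the cop can capture the robber. Similarly, if a cop starts in column $k$ with $n-4\le k\le n-2$ and the robber starts in a column with index larger than $k$, then the cop can capture the robber.
   Context: Bridge-burning Cops and Robbers is played on a finite graph $G$ by a team of cops and a single robber, with full information. First each cop chooses a starting vertex (several cops may share a vertex), then the robber chooses a starting vertex. The game then proceeds in rounds; in each round, first every cop either stays put or moves along an edge of the current graph to an adjacent vertex, and then the robber either stays put or moves along an edge of the current graph. Every edge traversed by the robber is immediately deleted from the graph (cop moves delete nothing). The cops win if at some moment some cop occupies the same vertex as the robber; the robber wins if he avoids this forever. The grid $G_{m,n}$ is the Cartesian product $P_n\,\Box\,P_m$, with vertex set $\{(i,j):0\le i\le n-1,\ 0\le j\le m-1\}$, where $(i,j)$ is adjacent to $(i',j')$ iff $|i-i'|+|j-j'|=1$. Vertex $(i,j)$ lies in column $i$ and row $j$. So $G_{2,n}$ has 2 rows and $n$ columns. -}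

module Defs where

open import Data.Nat using (ℕ; suc)
open import Data.Fin using (Fin; toℕ)
open import Data.Product using (_×_; _,_)
open import Data.Sum using (_⊎_)
open import Data.List using (List; _∷_; [])
open import Data.List.Membership.Propositional using (_∈_)
open import Relation.Nullary using (¬_)
open import Relation.Binary.PropositionalEquality using (_≡_; _≢_)

-- Vertices of the grid G_{2,n}: (column i, row r) with 0 ≤ i ≤ n-1, r ∈ {0,1}.
Vertex : ℕ → Set
Vertex n = Fin n × Fin 2

column : ∀ {n} → Vertex n → ℕ
column (i , _) = toℕ i

Adj : ∀ {n} → Vertex n → Vertex n → Set
Adj (i , a) (i' , a') =
  (i ≡ i' × a ≢ a') ⊎ (a ≡ a' × (suc (toℕ i) ≡ toℕ i' ⊎ suc (toℕ i') ≡ toℕ i))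

-- The current graph is the grid minus a list of deleted (burned) edges,
-- each stored as an ordered pair (either orientation removes the edge).
Burned : ℕ → Set
Burned n = List (Vertex n × Vertex n)

Present : ∀ {n} → Burned n → Vertex n → Vertex n → Set
Present D u v = Adj u v × ¬ ((u , v) ∈ D) × ¬ ((v , u) ∈ D)

data CopStep {n} (D : Burned n) : Vertex n → Vertex n → Set where
  stay : ∀ {c} → CopStep D c c
  move : ∀ {c c'} → Present D c c' → CopStep D c c'

data RobStep {n} (D : Burned n) : Vertex n → Vertex n → Burned n → Set where
  stay : ∀ {r} → RobStep D r r D
  move : ∀ {r r'} → Present D r r' → RobStep D r r' ((r , r') ∷ D)

-- CopWins D c r : in the current graph (grid minus D), with the cop at c and
-- the robber at r, and the cop about to move, the (single) cop has a strategy
-- that forces capture in finitely many rounds.  (Capture happens when the cop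
-- moves onto the robber, or the robber moves onto the cop.)
data CopWins {n} (D : Burned n) (c r : Vertex n) : Set where
  win : (c' : Vertex n) → CopStep D c c' →
        (c' ≡ r ⊎
         (∀ r' D' → RobStep D r r' D' → r' ≡ c' ⊎ CopWins D' c' r')) →
        CopWins D c r

module Submission where

-- Proof plan.
--  * Running right is hopeless: if the robber has just fled from column i to
--    column i+1 along one row, the cop stands in column i of the other row,
--    and every burned edge lies in columns ≤ i, then the cop shadows him in
--    the other row until the end of the grid (induction on the robber's
--    column, downwards).
--  * A bounded game search: a boolean function that looks for a capture
--    strategy of bounded depth in which the cop only stays or moves
--    vertically or to the left, and in which the robber's escapes to the
--    right are answered by the previous lemma.

open import Defs
open import Data.Bool using (Bool; true; false; T; _∧_; _∨_)
open import Data.Bool.Properties using (T-∧; T-∨)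
open import Data.Empty using (⊥; ⊥-elim)
open import Data.Fin using (Fin; zero; suc; toℕ; inject₁; opposite) renaming (_>_ to _>ᶠ_)
open import Data.Fin.Induction using (>-wellFounded)
open import Data.Fin.Properties
  using (_≟_; toℕ-injective; toℕ-inject₁; toℕ<n; opposite-prop; opposite-involutive)
open import Data.List using ([]; _∷_; map)
open import Data.List.Membership.Propositional using (_∈_)
open import Data.List.Membership.Propositional.Properties using (∈-map⁺)
import Data.List.Membership.DecPropositional as DecMembership
open import Data.List.Relation.Unary.All as All using (All; []; _∷_)
open import Data.List.Relation.Unary.Any using (here; there)
open import Data.Maybe using (Maybe; just; nothing)
import Data.Maybe as Maybe
open import Data.Nat using (ℕ; zero; suc; _+_; _∸_; _≤_; _<_; _≤?_; s≤s; s≤s⁻¹)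
open import Data.Nat.Properties
  using (≤-refl; ≤-trans; ≤-reflexive; <⇒≱; n≤1+n; suc-injective; +-comm; +-monoʳ-≤;
         +-∸-assoc; m≤n+m∸n; m≤n+o⇒m∸n≤o; ∸-monoʳ-<; module ≤-Reasoning)
open import Data.Product using (_×_; _,_; proj₁; proj₂)
open import Data.Product.Properties using (≡-dec)
open import Data.Sum using (_⊎_; inj₁; inj₂)
open import Function using (_∘_)
open import Function.Bundles using (Equivalence)
open import Induction.WellFounded using (Acc; acc)
open import Relation.Binary.Definitions using (DecidableEquality)
open import Relation.Binary.PropositionalEquality
  using (_≡_; _≢_; refl; sym; trans; cong; cong₂; subst; subst₂; module ≡-Reasoning)
open import Relation.Nullary using (¬_; Dec; yes; no; ¬?)
open import Relation.Nullary.Decidable using (isYes; toWitness; _×-dec_)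

private
  variable
    n : ℕ

otherRow : Fin 2 → Fin 2
otherRow zero    = suc zero
otherRow (suc _) = zero

otherRow-≢ : ∀ a → a ≢ otherRow a
otherRow-≢ zero       ()
otherRow-≢ (suc zero) ()

twoRows : ∀ {a b c : Fin 2} → a ≢ b → a ≢ c → b ≡ c
twoRows {zero}     {zero}                a≢b _   = ⊥-elim (a≢b refl)
twoRows {zero}     {suc zero} {zero}     _   a≢c = ⊥-elim (a≢c refl)
twoRows {zero}     {suc zero} {suc zero} _   _   = refl
twoRows {suc zero} {suc zero}            a≢b _   = ⊥-elim (a≢b refl)
twoRows {suc zero} {zero}     {zero}     _   _   = refl
twoRows {suc zero} {zero}     {suc zero} _   a≢c = ⊥-elim (a≢c refl)

leftOf : Fin n → Maybe (Fin n)
leftOf zero    = nothing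
leftOf (suc i) = just (inject₁ i)

leftOf-complete : ∀ {i i' : Fin n} → suc (toℕ i') ≡ toℕ i → leftOf i ≡ just i'
leftOf-complete {i = suc i} e =
  cong just (toℕ-injective (trans (toℕ-inject₁ i) (sym (suc-injective e))))

rightOf : Fin n → Maybe (Fin n)
rightOf {suc zero}    zero    = nothing
rightOf {suc (suc _)} zero    = just (suc zero)
rightOf               (suc i) = Maybe.map suc (rightOf i)

-- rightOf finds every right neighbour.  On the grids of interest it
-- computes only up to the first column whose successor is not literally
-- known; the search never asks beyond that.
rightOf-complete : ∀ {i i' : Fin n} → suc (toℕ i) ≡ toℕ i' → rightOf i ≡ just i'
rightOf-complete {suc (suc _)} {zero}  {suc zero} refl = refl
rightOf-complete {_}           {suc i} {suc i'}   e
  rewrite rightOf-complete {i = i} {i'} (suc-injective e) = refl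

_≟ᵥ_ : DecidableEquality (Vertex n)
_≟ᵥ_ = ≡-dec _≟_ _≟_

_≟ₑ_ : DecidableEquality (Vertex n × Vertex n)
_≟ₑ_ = ≡-dec _≟ᵥ_ _≟ᵥ_

Unburned : Burned n → Vertex n → Vertex n → Set
Unburned D u v = ¬ (u , v) ∈ D × ¬ (v , u) ∈ D

unburned? : (D : Burned n) (u v : Vertex n) → Dec (Unburned D u v)
unburned? {n} D u v = ¬? ((u , v) ∈? D) ×-dec ¬? ((v , u) ∈? D)
  where open DecMembership (_≟ₑ_ {n}) using (_∈?_)

BurnedWithin : Burned n → ℕ → Set
BurnedWithin D k = All (λ e → column (proj₁ e) ≤ k × column (proj₂ e) ≤ k) D

burnedWithin? : (D : Burned n) (k : ℕ) → Dec (BurnedWithin D k)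
burnedWithin? D k =
  All.all? (λ e → (column (proj₁ e) ≤? k) ×-dec (column (proj₂ e) ≤? k)) D

unburnedBeyond : ∀ {D : Burned n} {k u v} → BurnedWithin D k →
                 k < column u ⊎ k < column v → ¬ (u , v) ∈ D
unburnedBeyond within beyond m with All.lookup within m | beyond
... | (u≤k , _) | inj₁ k<u = <⇒≱ k<u u≤k
... | (_ , v≤k) | inj₂ k<v = <⇒≱ k<v v≤k

burnedWithin-weaken : ∀ {D : Burned n} {k k'} → k ≤ k' → BurnedWithin D k → BurnedWithin D k'
burnedWithin-weaken k≤k' = All.map λ { (u≤k , v≤k) → ≤-trans u≤k k≤k' , ≤-trans v≤k k≤k' }

-- The cop steps to (i' , b): the robber can neither stay,
-- nor turn (onto the cop), nor go back (burned), so he must run on and the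
-- same situation recurs one column further right.
runningRightLoses : ∀ (D : Burned n) {i i' : Fin n} {a b : Fin 2} → a ≢ b →
  suc (toℕ i) ≡ toℕ i' → BurnedWithin D (toℕ i) →
  CopWins (((i , a) , (i' , a)) ∷ D) (i , b) (i' , a)
runningRightLoses D a≢b step within = chase D a≢b step within (>-wellFounded _)
  where
  chase : ∀ (D : Burned n) {i i' : Fin n} {a b : Fin 2} → a ≢ b →
    suc (toℕ i) ≡ toℕ i' → BurnedWithin D (toℕ i) → Acc _>ᶠ_ i' →
    CopWins (((i , a) , (i' , a)) ∷ D) (i , b) (i' , a)
  chase D {i} {i'} {a} {b} a≢b step within (acc further) =
    win (i' , b) (move (inj₂ (refl , inj₁ step) , copEdge)) (inj₂ reply)
    where
    D₁ = ((i , a) , (i' , a)) ∷ D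
    i<i' : toℕ i < toℕ i'
    i<i' = ≤-reflexive step
    rowMismatch : ∀ {x y : Fin n} → (x , b) ≡ (y , a) → ⊥
    rowMismatch eq = a≢b (sym (cong proj₂ eq))
    copEdge : Unburned D₁ (i , b) (i' , b)
    copEdge = (λ { (here eq) → rowMismatch (cong proj₁ eq)
                 ; (there m) → unburnedBeyond within (inj₂ i<i') m })
            , (λ { (here eq) → rowMismatch (cong proj₁ eq)
                 ; (there m) → unburnedBeyond within (inj₁ i<i') m })
    rungUnburned : Unburned D₁ (i' , b) (i' , a)
    rungUnburned = (λ { (here eq) → rowMismatch (cong proj₁ eq)
                      ; (there m) → unburnedBeyond within (inj₁ i<i') m })
                 , (λ { (here eq) → rowMismatch (cong proj₂ eq)
                      ; (there m) → unburnedBeyond within (inj₁ i<i') m })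
    reply : ∀ r' D' → RobStep D₁ (i' , a) r' D' → r' ≡ (i' , b) ⊎ CopWins D' (i' , b) r'
    reply _ _ stay =
      inj₂ (win (i' , a) (move (inj₁ (refl , a≢b ∘ sym) , rungUnburned)) (inj₁ refl))
    reply _ _ (move (inj₁ (refl , a≢c) , _)) = inj₁ (cong (i' ,_) (twoRows a≢c a≢b))
    reply _ _ (move (inj₂ (refl , inj₁ step') , _)) =
      inj₂ (chase D₁ a≢b step'
              ((i≤i' , ≤-refl) ∷ burnedWithin-weaken i≤i' within)
              (further (≤-reflexive step')))
      where i≤i' = ≤-trans (n≤1+n _) i<i'
    reply _ _ (move (inj₂ (refl , inj₂ back) , _ , burnedBack))
      with toℕ-injective {i = i} (suc-injective (trans step (sym back)))
    ... | refl = ⊥-elim (burnedBack (here refl))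

AfterCopMove : Burned n → Vertex n → Vertex n → Set
AfterCopMove D c r = c ≡ r ⊎ (∀ r' D' → RobStep D r r' D' → r' ≡ c ⊎ CopWins D' c r')

-- A robber move needs an unburned edge; illegal moves are not examined.
whenUnburned : ∀ {D : Burned n} {u v} → Dec (Unburned D u v) → Bool → Bool
whenUnburned (yes _) b = b
whenUnburned (no _)  _ = true

whenUnburned-sound : ∀ {D : Burned n} {u v} (d : Dec (Unburned D u v)) {b} →
                     T (whenUnburned d b) → Unburned D u v → T b
whenUnburned-sound (yes _) t _ = t
whenUnburned-sound (no ¬p) _ p = ⊥-elim (¬p p)

-- copWinsWithin k D c r: the cop, to move, captures within k rounds by
-- moving left, vertically, or staying.  robberLosesWithin k D c r: the cop
-- has moved to c, and every robber reply (stay, turn, left, right) loses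
-- within k rounds; a run to the right is settled by runningRightLoses
-- when the cop stands level with the robber.
copWinsWithin     : ℕ → Burned n → Vertex n → Vertex n → Bool
copMovesLeft      : ℕ → Burned n → Vertex n → Vertex n → Maybe (Fin n) → Bool
copMovesTo        : ℕ → Burned n → Vertex n → Vertex n → Vertex n → Bool
afterCopMove      : ℕ → Burned n → Vertex n → Vertex n → Bool
robberLosesWithin : ℕ → Burned n → Vertex n → Vertex n → Bool
robberMovesRight  : ℕ → Burned n → Vertex n → Vertex n → Bool
robberMovesInRow  : ℕ → Burned n → Vertex n → Vertex n → Maybe (Fin n) → Bool
robberMovesTo     : ℕ → Burned n → Vertex n → Vertex n → Vertex n → Bool
afterRobberMove   : ℕ → Burned n → Vertex n → Vertex n → Burned n → Bool

copWinsWithin zero    D c       r = false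
copWinsWithin (suc k) D (i , a) r =
  copMovesLeft k D (i , a) r (leftOf i)
  ∨ copMovesTo k D (i , a) r (i , otherRow a)
  ∨ afterCopMove k D (i , a) r

copMovesLeft k D c       r nothing   = false
copMovesLeft k D (i , a) r (just i') = copMovesTo k D (i , a) r (i' , a)

copMovesTo k D c r c' = isYes (unburned? D c c') ∧ afterCopMove k D c' r

afterCopMove k D c r = isYes (c ≟ᵥ r) ∨ robberLosesWithin k D c r

robberLosesWithin k D c (i , a) =
  afterRobberMove k D c (i , a) D
  ∧ robberMovesTo k D c (i , a) (i , otherRow a)
  ∧ robberMovesInRow k D c (i , a) (leftOf i)
  ∧ robberMovesRight k D c (i , a)

robberMovesRight k D c (i , a) =
  (isYes (c ≟ᵥ (i , otherRow a)) ∧ isYes (burnedWithin? D (toℕ i)))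
  ∨ robberMovesInRow k D c (i , a) (rightOf i)

robberMovesInRow k D c r       nothing   = true
robberMovesInRow k D c (i , a) (just i') = robberMovesTo k D c (i , a) (i' , a)

robberMovesTo k D c r r' =
  whenUnburned (unburned? D r r') (afterRobberMove k D c r' ((r , r') ∷ D))

afterRobberMove k D c r' D' = isYes (r' ≟ᵥ c) ∨ copWinsWithin k D' c r'

∧-split : ∀ x {y} → T (x ∧ y) → T x × T y
∧-split _ = Equivalence.to T-∧

∨-split : ∀ x {y} → T (x ∨ y) → T x ⊎ T y
∨-split _ = Equivalence.to T-∨

copWinsWithin-sound : ∀ k (D : Burned n) c r → T (copWinsWithin k D c r) → CopWins D c r
copMovesLeft-sound : ∀ k (D : Burned n) i a r →
  T (copMovesLeft k D (i , a) r (leftOf i)) → CopWins D (i , a) r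
copMovesTo-sound : ∀ k (D : Burned n) c r c' → Adj c c' →
  T (copMovesTo k D c r c') → CopWins D c r
afterCopMove-sound : ∀ k (D : Burned n) c r → T (afterCopMove k D c r) → AfterCopMove D c r
robberLosesWithin-sound : ∀ k (D : Burned n) c r → T (robberLosesWithin k D c r) →
  ∀ {r' D'} → RobStep D r r' D' → r' ≡ c ⊎ CopWins D' c r'
robberReplies-sound : ∀ k (D : Burned n) c i a →
  T (afterRobberMove k D c (i , a) D) →
  T (robberMovesTo k D c (i , a) (i , otherRow a)) →
  T (robberMovesInRow k D c (i , a) (leftOf i)) →
  T (robberMovesRight k D c (i , a)) →
  ∀ {r' D'} → RobStep D (i , a) r' D' → r' ≡ c ⊎ CopWins D' c r'
robberMovesTo-sound : ∀ k (D : Burned n) c r r' → T (robberMovesTo k D c r r') →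
  Unburned D r r' → r' ≡ c ⊎ CopWins ((r , r') ∷ D) c r'
afterRobberMove-sound : ∀ k (D : Burned n) c r' D' →
  T (afterRobberMove k D c r' D') → r' ≡ c ⊎ CopWins D' c r'

copWinsWithin-sound (suc k) D (i , a) r t
  with ∨-split (copMovesLeft k D (i , a) r (leftOf i)) t
... | inj₁ left = copMovesLeft-sound k D i a r left
... | inj₂ t' with ∨-split (copMovesTo k D (i , a) r (i , otherRow a)) t'
...   | inj₁ turns = copMovesTo-sound k D _ r _ (inj₁ (refl , otherRow-≢ a)) turns
...   | inj₂ stays = win (i , a) stay (afterCopMove-sound k D _ r stays)

copMovesLeft-sound k D zero    a r ()
copMovesLeft-sound k D (suc i) a r t =
  copMovesTo-sound k D _ r _ (inj₂ (refl , inj₂ (cong suc (toℕ-inject₁ i)))) t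

copMovesTo-sound k D c r c' adj t with ∧-split (isYes (unburned? D c c')) t
... | (unburned , after) =
      win c' (move (adj , toWitness unburned)) (afterCopMove-sound k D c' r after)

afterCopMove-sound k D c r t with ∨-split (isYes (c ≟ᵥ r)) t
... | inj₁ caught = inj₁ (toWitness caught)
... | inj₂ loses  = inj₂ (λ _ _ → robberLosesWithin-sound k D c r loses)

robberLosesWithin-sound k D c (i , a) t
  with ∧-split (afterRobberMove k D c (i , a) D) t
... | (stays , t₁) with ∧-split (robberMovesTo k D c (i , a) (i , otherRow a)) t₁
... | (turns , t₂) with ∧-split (robberMovesInRow k D c (i , a) (leftOf i)) t₂
... | (left , right) = robberReplies-sound k D c i a stays turns left right

robberReplies-sound k D c i a stays turns left right stay =
  afterRobberMove-sound k D c _ D stays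
robberReplies-sound k D c i a stays turns left right (move (inj₁ (refl , a≢b) , unburned))
  with twoRows (otherRow-≢ a) a≢b
... | refl = robberMovesTo-sound k D c _ _ turns unburned
robberReplies-sound k D c i a stays turns left right (move (inj₂ (refl , inj₂ back) , unburned)) =
  robberMovesTo-sound k D c _ _
    (subst (T ∘ robberMovesInRow k D c (i , a)) (leftOf-complete back) left) unburned
robberReplies-sound k D c i a stays turns left right (move (inj₂ (refl , inj₁ forth) , unburned))
  with ∨-split (isYes (c ≟ᵥ (i , otherRow a)) ∧ isYes (burnedWithin? D (toℕ i))) right
... | inj₂ runs =
  robberMovesTo-sound k D c _ _
    (subst (T ∘ robberMovesInRow k D c (i , a)) (rightOf-complete forth) runs) unburned
... | inj₁ level with ∧-split (isYes (c ≟ᵥ (i , otherRow a))) level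
...   | (atOtherRow , within) with toWitness {a? = c ≟ᵥ (i , otherRow a)} atOtherRow
...     | refl = inj₂ (runningRightLoses D (otherRow-≢ a) forth (toWitness within))

robberMovesTo-sound k D c r r' t unburned =
  afterRobberMove-sound k D c r' _ (whenUnburned-sound (unburned? D r r') t unburned)

afterRobberMove-sound k D c r' D' t with ∨-split (isYes (r' ≟ᵥ c)) t
... | inj₁ caught = inj₁ (toWitness caught)
... | inj₂ wins   = inj₂ (copWinsWithin-sound k D' c r' wins)

allColumnsBelow : Fin n → (Fin n → Bool) → Bool
allColumnsBelow zero    f = true
allColumnsBelow (suc j) f = f zero ∧ allColumnsBelow j (f ∘ suc)

allColumnsBelow-sound : ∀ (j : Fin n) f → T (allColumnsBelow j f) →
                        ∀ i → toℕ i < toℕ j → T (f i)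
allColumnsBelow-sound (suc j) f t zero    _   = proj₁ (∧-split (f zero) t)
allColumnsBelow-sound (suc j) f t (suc i) i<j =
  allColumnsBelow-sound j (f ∘ suc) (proj₂ (∧-split (f zero) t)) i (s≤s⁻¹ i<j)

allRows : (Fin 2 → Bool) → Bool
allRows f = f zero ∧ f (suc zero)

allRows-sound : ∀ f → T (allRows f) → ∀ a → T (f a)
allRows-sound f t zero       = proj₁ (∧-split (f zero) t)
allRows-sound f t (suc zero) = proj₂ (∧-split (f zero) t)

startWins : Fin n → Fin n → Fin 2 → Fin 2 → Bool
startWins j i a b = copWinsWithin 6 [] (j , b) (i , a)

leftStartsWin : Fin n → Bool
leftStartsWin j = allColumnsBelow j λ i → allRows λ a → allRows (startWins j i a)

-- For j ≤ 3 this is a finite computation, whatever the width n ≥ j + 1.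
leftStartsWin-small : ∀ (j : Fin n) → toℕ j ≤ 3 → T (leftStartsWin j)
leftStartsWin-small zero                      _ = _
leftStartsWin-small (suc zero)                _ = _
leftStartsWin-small (suc (suc zero))          _ = _
leftStartsWin-small (suc (suc (suc zero)))    _ = _
leftStartsWin-small (suc (suc (suc (suc _)))) (s≤s (s≤s (s≤s ())))

copWinsFromLeftEnd : ∀ (j : Fin n) (b : Fin 2) (r : Vertex n) →
  toℕ j ≤ 3 → column r < toℕ j → CopWins [] (j , b) r
copWinsFromLeftEnd j b (i , a) j≤3 i<j =
  copWinsWithin-sound 6 [] (j , b) (i , a)
    (allRows-sound (startWins j i a)
      (allRows-sound (λ a → allRows (startWins j i a))
        (allColumnsBelow-sound j (λ i → allRows λ a → allRows (startWins j i a))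
          (leftStartsWin-small j j≤3) i i<j) a) b)

mirror : Vertex n → Vertex n
mirror (i , a) = opposite i , a

mirror-involutive : ∀ (v : Vertex n) → mirror (mirror v) ≡ v
mirror-involutive (i , a) = cong (_, a) (opposite-involutive i)

mirrorEdge : Vertex n × Vertex n → Vertex n × Vertex n
mirrorEdge (u , v) = mirror u , mirror v

mirrorEdge-involutive : ∀ (e : Vertex n × Vertex n) → mirrorEdge (mirrorEdge e) ≡ e
mirrorEdge-involutive (u , v) = cong₂ _,_ (mirror-involutive u) (mirror-involutive v)

mirrorBurned : Burned n → Burned n
mirrorBurned = map mirrorEdge

mirrorBurned-involutive : ∀ (D : Burned n) → mirrorBurned (mirrorBurned D) ≡ D
mirrorBurned-involutive []            = refl
mirrorBurned-involutive (e ∷ D) =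
  cong₂ _∷_ (mirrorEdge-involutive e) (mirrorBurned-involutive D)

opposite-step : ∀ {i i' : Fin n} → suc (toℕ i) ≡ toℕ i' →
                suc (toℕ (opposite i')) ≡ toℕ (opposite i)
opposite-step {n} {i} {i'} step = begin
  suc (toℕ (opposite i'))   ≡⟨ cong suc (opposite-prop i') ⟩
  suc (n ∸ suc (toℕ i'))    ≡⟨ sym (+-∸-assoc 1 (toℕ<n i')) ⟩
  n ∸ toℕ i'                ≡⟨ cong (n ∸_) (sym step) ⟩
  n ∸ suc (toℕ i)           ≡⟨ sym (opposite-prop i) ⟩
  toℕ (opposite i)          ∎
  where open ≡-Reasoning

mirror-Adj : ∀ {u v : Vertex n} → Adj u v → Adj (mirror u) (mirror v)
mirror-Adj (inj₁ (refl , a≢b))       = inj₁ (refl , a≢b)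
mirror-Adj (inj₂ (refl , inj₁ step)) = inj₂ (refl , inj₂ (opposite-step step))
mirror-Adj (inj₂ (refl , inj₂ step)) = inj₂ (refl , inj₁ (opposite-step step))

mirror-Present : ∀ {D : Burned n} {u v} → Present D u v →
                 Present (mirrorBurned D) (mirror u) (mirror v)
mirror-Present {D = D} (adj , ¬uv , ¬vu) =
  mirror-Adj adj , unmirror ¬uv , unmirror ¬vu
  where
  unmirror : ∀ {e} → ¬ e ∈ D → ¬ mirrorEdge e ∈ mirrorBurned D
  unmirror {e} ¬e m =
    ¬e (subst₂ _∈_ (mirrorEdge-involutive e) (mirrorBurned-involutive D)
                   (∈-map⁺ mirrorEdge m))

unmirror-Present : ∀ {D : Burned n} {u v} → Present (mirrorBurned D) u v →
                   Present D (mirror u) (mirror v)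
unmirror-Present {D = D} p =
  subst (λ D → Present D _ _) (mirrorBurned-involutive D) (mirror-Present p)

mirrorWins : ∀ {D : Burned n} {c r} → CopWins D c r →
             CopWins (mirrorBurned D) (mirror c) (mirror r)
mirrorWins {D = D} {c} {r} (win c' copStep after) =
  win (mirror c') (mirrorStep copStep) (mirrorAfter after)
  where
  mirrorStep : ∀ {x} → CopStep D c x → CopStep (mirrorBurned D) (mirror c) (mirror x)
  mirrorStep stay     = stay
  mirrorStep (move p) = move (mirror-Present p)
  mirrorAfter : AfterCopMove D c' r → AfterCopMove (mirrorBurned D) (mirror c') (mirror r)
  mirrorAfter (inj₁ caught) = inj₁ (cong mirror caught)
  mirrorAfter (inj₂ replies) = inj₂ reply
    where
    reply : ∀ r' D' → RobStep (mirrorBurned D) (mirror r) r' D' →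
            r' ≡ mirror c' ⊎ CopWins D' (mirror c') r'
    reply _ _ stay with replies r D stay
    ... | inj₁ caught = inj₁ (cong mirror caught)
    ... | inj₂ wins   = inj₂ (mirrorWins wins)
    reply r' _ (move p)
      with replies (mirror r') ((r , mirror r') ∷ D)
             (move (subst (λ x → Present D x (mirror r')) (mirror-involutive r)
                          (unmirror-Present p)))
    ... | inj₁ caught = inj₁ (trans (sym (mirror-involutive r')) (cong mirror caught))
    ... | inj₂ wins   =
      inj₂ (subst (λ x → CopWins ((mirror r , x) ∷ mirrorBurned D) (mirror c') x)
                  (mirror-involutive r') (mirrorWins wins))

-- Reflecting the cop at column k and a robber to his right puts the robber
-- left of a cop in column n ∸ (k + 1) ≤ 3.
copWinsFromRightEnd : ∀ (k : Fin n) (b : Fin 2) (r : Vertex n) →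
  n ∸ 4 ≤ toℕ k → toℕ k < column r → CopWins [] (k , b) r
copWinsFromRightEnd {n} k b (i , a) n∸4≤k k<i =
  subst₂ (CopWins []) (cong (_, b) (opposite-involutive k)) (mirror-involutive (i , a))
    (mirrorWins (copWinsFromLeftEnd (opposite k) b (opposite i , a) k'≤3 i'<k'))
  where
  k'≤3 : toℕ (opposite k) ≤ 3
  k'≤3 = subst (_≤ 3) (sym (opposite-prop k))
           (m≤n+o⇒m∸n≤o n (suc (toℕ k)) (begin
             n                    ≤⟨ m≤n+m∸n n 4 ⟩
             4 + (n ∸ 4)          ≤⟨ +-monoʳ-≤ 4 n∸4≤k ⟩
             4 + toℕ k            ≡⟨ cong suc (+-comm 3 (toℕ k)) ⟩
             suc (toℕ k) + 3      ∎))
    where open ≤-Reasoning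
  i'<k' : toℕ (opposite i) < toℕ (opposite k)
  i'<k' = subst₂ _<_ (sym (opposite-prop i)) (sym (opposite-prop k))
            (∸-monoʳ-< (s≤s k<i) (toℕ<n i))

-- Lemma 4.1.
lemma4p1 : (n : ℕ) →
    (∀ (j : Fin n) (cr : Fin 2) (r : Vertex n) →
       1 ≤ toℕ j → toℕ j ≤ 3 → column r < toℕ j →
       CopWins [] (j , cr) r)
    × (∀ (k : Fin n) (cr : Fin 2) (r : Vertex n) →
       n ∸ 4 ≤ toℕ k → toℕ k ≤ n ∸ 2 → toℕ k < column r →
       CopWins [] (k , cr) r)
lemma4p1 n =
  (λ j cr r _ j≤3 r<j → copWinsFromLeftEnd j cr r j≤3 r<j) ,
  (λ k cr r n∸4≤k _ k<r → copWinsFromRightEnd k cr r n∸4≤k k<r)
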